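{- A bipartite graph $B$ is of Ferrers dimension at most $2$ if and only if $\widehat{B}$ is a $2$-clique rectangular graph.
   Context: For a bipartite graph (bigraph) $B$ with partite sets $X,Y$ and biadjacency matrix $A$ (rows indexed by $X$, columns by $Y$), $\widehat{B}$ denotes the graph with adjacency matrix $\begin{pmatrix}\mathbf{1} & A\\ A^T & \mathbf{1}\end{pmatrix}$, i.e. $B$ with each partite set made into a clique and a loop added at every vertex. A Ferrers bigraph is a bigraph whose biadjacency matrix contains no $2\times 2$ permutation submatrix (equivalently, rows' neighbourhoods are linearly ordered by inclusion). The Ferrers dimension of a bigraph $B$ is the minimum number of Ferrers bigraphs whose intersection is $B$. A rectangular graph is an intersection graph of axis-parallel rectangles in $\mathbb{R}^2$; a $2$-clique rectangular graph is a rectangular graph whose vertices are covered by two disjoint cliques.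
   Formalization: The axis-parallel rectangles representing a rectangular graph have rational coordinates instead of lying in ℝ². -}

module Defs where

open import Data.Nat using (ℕ)
open import Data.Fin using (Fin)
open import Data.Bool using (Bool; true; false; _∧_)
open import Data.Sum using (_⊎_; inj₁; inj₂)
open import Data.Product using (_×_; Σ; ∃; ∃-syntax)
open import Data.Rational using (ℚ; _≤_)
open import Relation.Nullary using (¬_)
open import Relation.Binary.PropositionalEquality using (_≡_)
open import Function.Bundles using (_⇔_)

-- A bipartite graph with partite sets X = Fin m, Y = Fin n is given by its
-- biadjacency matrix (rows indexed by X, columns by Y).
BiadjMatrix : ℕ → ℕ → Set
BiadjMatrix m n = Fin m → Fin n → Bool

-- Ferrers bigraph: the biadjacency matrix contains no 2×2 permutation submatrix.
-- (The anti-diagonal pattern is the same condition with rows i, i' swapped.)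
Ferrers : ∀ {m n} → BiadjMatrix m n → Set
Ferrers {m} {n} A =
  (i i' : Fin m) (j j' : Fin n) →
  ¬ (A i j ≡ true × A i' j' ≡ true × A i j' ≡ false × A i' j ≡ false)

-- Ferrers dimension at most 2: B is the intersection of (at most) two Ferrers
-- bigraphs on the same partite sets.  (Dimension 0 or 1 is covered by taking
-- F₁ = F₂, since the complete bigraph and any single Ferrers bigraph are Ferrers.)
FerrersDimAtMost2 : ∀ {m n} → BiadjMatrix m n → Set
FerrersDimAtMost2 {m} {n} A =
  Σ (BiadjMatrix m n) λ F₁ → Σ (BiadjMatrix m n) λ F₂ →
    Ferrers F₁ × Ferrers F₂ × ((i : Fin m) (j : Fin n) → A i j ≡ (F₁ i j ∧ F₂ i j))

-- A (finite) graph, possibly with loops, given by a Boolean adjacency relation.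
Graph : Set → Set
Graph V = V → V → Bool

-- \widehat{B}: vertex set X ⊔ Y, adjacency matrix ( 1 A ; Aᵀ 1 ).
hat : ∀ {m n} → BiadjMatrix m n → Graph (Fin m ⊎ Fin n)
hat A (inj₁ _) (inj₁ _) = true
hat A (inj₁ i) (inj₂ j) = A i j
hat A (inj₂ j) (inj₁ i) = A i j
hat A (inj₂ _) (inj₂ _) = true

-- Closed axis-parallel rectangle [x₁,x₂] × [y₁,y₂] in the plane.
-- FIDELITY: coordinates are rational (no reals in agda-stdlib); for finite
-- intersection graphs this loses nothing.
record Rect : Set where
  constructor rect
  field
    x₁ x₂ y₁ y₂ : ℚ

_∈R_ : ℚ × ℚ → Rect → Set
(x Data.Product., y) ∈R r = (x₁ ≤ x × x ≤ x₂) × (y₁ ≤ y × y ≤ y₂)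
  where open Rect r

Intersect : Rect → Rect → Set
Intersect r s = ∃[ p ] (p ∈R r × p ∈R s)

-- Rectangular graph: intersection graph of axis-parallel rectangles, i.e.
-- u ~ v (including u = v, loops) iff the rectangles of u and v intersect.
Rectangular : {V : Set} → Graph V → Set
Rectangular {V} G = Σ (V → Rect) λ R → (u v : V) → (G u v ≡ true) ⇔ Intersect (R u) (R v)

-- Vertices covered by two disjoint cliques: a 2-colouring c of the vertices
-- such that any two distinct vertices of the same colour are adjacent.
TwoCliqueCover : {V : Set} → Graph V → Set
TwoCliqueCover {V} G = Σ (V → Bool) λ c → (u v : V) → ¬ (u ≡ v) → c u ≡ c v → G u v ≡ true

TwoCliqueRectangular : {V : Set} → Graph V → Set
TwoCliqueRectangular G = Rectangular G × TwoCliqueCover G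

module Submission where

-- A bigraph F is Ferrers exactly when it is a threshold bigraph: there are
-- numbers deg(i) for rows and thr(j) for columns with F i j ⇔ thr j ≤ deg i.
-- (Take deg i = size of row i and thr j = number of columns whose column set
-- contains that of j; the Ferrers condition makes every row either contain
-- all those columns or miss j.)
--
-- (⇒) If A = F₁ ∩ F₂ with threshold data (deg₁,thr₁) and (deg₂,thr₂), give
-- row i the box [0,deg₁ i]×[0,deg₂ i] and column j the box [thr₁ j,n]×[thr₂ j,n].
-- Row boxes share the origin, column boxes share (n,n), and a row box meets a
-- column box iff thr₁ j ≤ deg₁ i and thr₂ j ≤ deg₂ i, i.e. iff A i j.
-- The partite sets are the two cliques of the cover.
-- (⇐) Boxes meet iff both coordinate projections overlap, so A is the
-- intersection of the two "projections overlap" bigraphs; each is Ferrers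
-- because the row intervals pairwise overlap, and so do the column intervals.

open import Defs
open import Data.Nat using (ℕ; z≤n)
open import Function.Bundles using (_⇔_)

import Data.Nat as ℕ
import Data.Nat.Properties as ℕ
import Data.Nat.Coprimality as Coprime
open import Data.Integer using (+_)
import Data.Integer as ℤ
import Data.Integer.Properties as ℤ
open import Data.Rational using (ℚ; mkℚ; *≤*)
import Data.Rational as ℚ
import Data.Rational.Properties as ℚ
open import Data.Fin using (Fin)
open import Data.Fin.Properties using (all?)
open import Data.Fin.Subset using (Subset; _∈_; _⊆_; _⊂_; ∣_∣)
open import Data.Fin.Subset.Properties using (p⊆q⇒∣p∣≤∣q∣; p⊂q⇒∣p∣<∣q∣; ∣p∣≤n)
open import Data.Vec using (tabulate)
open import Data.Vec.Properties using ([]=⇒lookup; lookup⇒[]=; lookup∘tabulate)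
open import Data.Bool using (Bool; true; false; _∧_)
open import Data.Bool.Properties using (¬-not) renaming (_≟_ to _≟ᵇ_)
open import Data.Product using (_×_; _,_; proj₁; proj₂; Σ)
open import Data.Product.Function.NonDependent.Propositional using (_×-⇔_)
open import Data.Sum using (_⊎_; inj₁; inj₂)
open import Relation.Nullary using (¬_; Dec; yes; no; does; _→-dec_; _×-dec_; contradiction)
open import Relation.Nullary.Decidable using (dec-true)
open import Relation.Binary.PropositionalEquality using (_≡_; refl; sym; trans; subst₂)
open import Function.Bundles using (mk⇔; Equivalence)
open Equivalence using (to; from)
import Function.Properties.Equivalence as ⇔
open import Function.Related.Propositional using (module EquationalReasoning)

∧-true : ∀ {a b} → a ∧ b ≡ true ⇔ (a ≡ true × b ≡ true)
∧-true {true}  {true}  = mk⇔ (λ _ → refl , refl) (λ _ → refl)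
∧-true {true}  {false} = mk⇔ (λ ()) (λ ())
∧-true {false}         = mk⇔ (λ ()) (λ ())

bool-ext : ∀ {a b} → (a ≡ true ⇔ b ≡ true) → a ≡ b
bool-ext {true}          a⇔b = sym (to a⇔b refl)
bool-ext {false} {true}  a⇔b = from a⇔b refl
bool-ext {false} {false} _   = refl

≡-true-cong : ∀ {a b} → a ≡ b → (a ≡ true) ⇔ (b ≡ true)
≡-true-cong refl = ⇔.refl

always : ∀ {p} {P : Set p} → P → (true ≡ true) ⇔ P
always p = mk⇔ (λ _ → p) (λ _ → refl)

does-true : ∀ {p} {P : Set p} (P? : Dec P) → does P? ≡ true ⇔ P
does-true (yes p)  = mk⇔ (λ _ → p) (λ _ → refl)
does-true (no ¬p)  = mk⇔ (λ ()) (λ p → contradiction p ¬p)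

does-false : ∀ {p} {P : Set p} (P? : Dec P) → does P? ≡ false → ¬ P
does-false P? ≡false p with () ← trans (sym ≡false) (dec-true P? p)

∈-tabulate : ∀ {k} (P : Fin k → Bool) {x : Fin k} → x ∈ tabulate P ⇔ P x ≡ true
∈-tabulate P {x} = mk⇔
  (λ x∈P → trans (sym (lookup∘tabulate P x)) ([]=⇒lookup x∈P))
  (λ Px  → lookup⇒[]= x (tabulate P) (trans (lookup∘tabulate P x) Px))

-- Thresholds are bounded by the
-- number of columns, which later gives all column boxes a common corner.
record Threshold {m n : ℕ} (F : BiadjMatrix m n) : Set where
  field
    deg   : Fin m → ℕ
    thr   : Fin n → ℕ
    thr≤n : ∀ j → thr j ℕ.≤ n
    spec  : ∀ i j → F i j ≡ true ⇔ thr j ℕ.≤ deg i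

-- Every Ferrers bigraph is a threshold bigraph, with deg i = |row i| and
-- thr j = |above j|, where above j is the set of columns whose column set
-- contains that of j.
module FerrersThreshold {m n : ℕ} (F : BiadjMatrix m n) (fer : Ferrers F) where

  ColumnLeq : Fin n → Fin n → Set
  ColumnLeq j j' = ∀ i → F i j ≡ true → F i j' ≡ true

  columnLeq? : ∀ j j' → Dec (ColumnLeq j j')
  columnLeq? j j' = all? (λ i → (F i j ≟ᵇ true) →-dec (F i j' ≟ᵇ true))

  row : Fin m → Subset n
  row i = tabulate (F i)

  above : Fin n → Subset n
  above j = tabulate (λ j' → does (columnLeq? j j'))

  ∈-above : ∀ {j j'} → j' ∈ above j ⇔ ColumnLeq j j'
  ∈-above {j} {j'} = ⇔.trans (∈-tabulate _) (does-true (columnLeq? j j'))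

  above⊆row : ∀ {i j} → F i j ≡ true → above j ⊆ row i
  above⊆row {i} Fij j'∈above = from (∈-tabulate (F i)) (to ∈-above j'∈above i Fij)

  -- If i misses j, every neighbour j' of i lies above j (otherwise rows i, i'
  -- and columns j, j' form a 2×2 permutation), and j itself witnesses strictness.
  row⊂above : ∀ {i j} → F i j ≡ false → row i ⊂ above j
  row⊂above {i} {j} ¬Fij = row⊆above , j , from ∈-above (λ _ Fi'j → Fi'j) , j∉row
    where
    row⊆above : row i ⊆ above j
    row⊆above {j'} j'∈row = from ∈-above λ i' Fi'j →
      ¬-not λ ¬Fi'j' → fer i' i j j' (Fi'j , to (∈-tabulate (F i)) j'∈row , ¬Fi'j' , ¬Fij)
    j∉row : ¬ (j ∈ row i)
    j∉row j∈row with () ← trans (sym ¬Fij) (to (∈-tabulate (F i)) j∈row)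

  threshold : Threshold F
  threshold = record
    { deg   = λ i → ∣ row i ∣
    ; thr   = λ j → ∣ above j ∣
    ; thr≤n = λ j → ∣p∣≤n (above j)
    ; spec  = λ i j → mk⇔
        (λ Fij → p⊆q⇒∣p∣≤∣q∣ (above⊆row Fij))
        (λ thr≤deg → ¬-not λ ¬Fij → ℕ.<⇒≱ (p⊂q⇒∣p∣<∣q∣ (row⊂above ¬Fij)) thr≤deg)
    }

toℚ : ℕ → ℚ
toℚ k = mkℚ (+ k) 0 (Coprime.sym (Coprime.1-coprimeTo k))

toℚ-≤ : ∀ {a b} → a ℕ.≤ b ⇔ toℚ a ℚ.≤ toℚ b
toℚ-≤ {a} {b} = mk⇔
  (λ a≤b → *≤* (subst₂ ℤ._≤_ (sym (ℤ.*-identityʳ (+ a))) (sym (ℤ.*-identityʳ (+ b))) (ℤ.+≤+ a≤b)))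
  (λ a≤b → ℤ.drop‿+≤+ (subst₂ ℤ._≤_ (ℤ.*-identityʳ (+ a)) (ℤ.*-identityʳ (+ b)) (ℚ.drop-*≤* a≤b)))

Interval : Set
Interval = ℚ × ℚ

Overlap : Interval → Interval → Set
Overlap I J = proj₁ I ℚ.≤ proj₂ J × proj₁ J ℚ.≤ proj₂ I

overlap? : ∀ I J → Dec (Overlap I J)
overlap? I J = (proj₁ I ℚ.≤? proj₂ J) ×-dec (proj₁ J ℚ.≤? proj₂ I)

separated : ∀ {I J} → ¬ Overlap I J → proj₂ J ℚ.< proj₁ I ⊎ proj₂ I ℚ.< proj₁ J
separated {I} {J} ¬IJ with proj₁ I ℚ.≤? proj₂ J
... | no  lo≰hi = inj₁ (ℚ.≰⇒> lo≰hi)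
... | yes lo≤hi = inj₂ (ℚ.≰⇒> λ lo≤hi' → ¬IJ (lo≤hi , lo≤hi'))

-- Two nonempty overlapping intervals share a point (the larger left end).
common-point : ∀ {a b c d} → a ℚ.≤ b → c ℚ.≤ d → Overlap (a , b) (c , d) →
  Σ ℚ λ p → (a ℚ.≤ p × p ℚ.≤ b) × (c ℚ.≤ p × p ℚ.≤ d)
common-point {a} {b} {c} {d} a≤b c≤d (a≤d , c≤b) with ℚ.≤-total a c
... | inj₁ a≤c = c , (a≤c , c≤b) , (ℚ.≤-refl , c≤d)
... | inj₂ c≤a = a , (ℚ.≤-refl , a≤b) , (c≤a , a≤d)

-- Interval bigraphs between two cliques are Ferrers: if the intervals I i
-- pairwise overlap and so do the intervals J j, then "I i overlaps J j" has no
-- 2×2 permutation; each of the four ways of separating the two non-edges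
-- yields a cycle of inequalities x < x.
module _ {m n : ℕ} (I : Fin m → Interval) (J : Fin n → Interval) where
  private
    a b : Fin m → ℚ
    a i = proj₁ (I i)
    b i = proj₂ (I i)
    c d : Fin n → ℚ
    c j = proj₁ (J j)
    d j = proj₂ (J j)

  overlap-ferrers : (∀ i i' → Overlap (I i) (I i')) → (∀ j j' → Overlap (J j) (J j')) →
    Ferrers (λ i j → does (overlap? (I i) (J j)))
  overlap-ferrers I-clique J-clique i i' j j' (ij , i'j' , ¬ij' , ¬i'j)
    with to (does-true (overlap? _ _)) ij | to (does-true (overlap? _ _)) i'j'
       | separated (does-false (overlap? _ _) ¬ij') | separated (does-false (overlap? _ _) ¬i'j)
  ... | ai≤dj , _ | ai'≤dj' , _ | inj₁ dj'<ai | inj₁ dj<ai' = ℚ.<-irrefl refl (begin-strict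
    a i' ≤⟨ ai'≤dj' ⟩ d j' <⟨ dj'<ai ⟩ a i ≤⟨ ai≤dj ⟩ d j <⟨ dj<ai' ⟩ a i' ∎)
    where open ℚ.≤-Reasoning
  ... | _ | _ | inj₁ dj'<ai | inj₂ bi'<cj = ℚ.<-irrefl refl (begin-strict
    d j' <⟨ dj'<ai ⟩ a i ≤⟨ proj₁ (I-clique i i') ⟩ b i' <⟨ bi'<cj ⟩ c j ≤⟨ proj₁ (J-clique j j') ⟩ d j' ∎)
    where open ℚ.≤-Reasoning
  ... | _ | _ | inj₂ bi<cj' | inj₁ dj<ai' = ℚ.<-irrefl refl (begin-strict
    b i <⟨ bi<cj' ⟩ c j' ≤⟨ proj₁ (J-clique j' j) ⟩ d j <⟨ dj<ai' ⟩ a i' ≤⟨ proj₁ (I-clique i' i) ⟩ b i ∎)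
    where open ℚ.≤-Reasoning
  ... | _ , cj≤bi | _ , cj'≤bi' | inj₂ bi<cj' | inj₂ bi'<cj = ℚ.<-irrefl refl (begin-strict
    b i <⟨ bi<cj' ⟩ c j' ≤⟨ cj'≤bi' ⟩ b i' <⟨ bi'<cj ⟩ c j ≤⟨ cj≤bi ⟩ b i ∎)
    where open ℚ.≤-Reasoning

open Rect

xI yI : Rect → Interval
xI r = x₁ r , x₂ r
yI r = y₁ r , y₂ r

NonEmpty : Rect → Set
NonEmpty r = x₁ r ℚ.≤ x₂ r × y₁ r ℚ.≤ y₂ r

Overlap² : Rect → Rect → Set
Overlap² r s = Overlap (xI r) (xI s) × Overlap (yI r) (yI s)

intersect⇒nonEmpty : ∀ {r s} → Intersect r s → NonEmpty r
intersect⇒nonEmpty (_ , ((x₁≤x , x≤x₂) , (y₁≤y , y≤y₂)) , _) =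
  ℚ.≤-trans x₁≤x x≤x₂ , ℚ.≤-trans y₁≤y y≤y₂

intersect-sym : ∀ {r s} → Intersect r s ⇔ Intersect s r
intersect-sym = mk⇔ swap swap
  where
  swap : ∀ {r s} → Intersect r s → Intersect s r
  swap (p , p∈r , p∈s) = p , p∈s , p∈r

intersect⇒overlap : ∀ {r s} → Intersect r s → Overlap² r s
intersect⇒overlap (_ , ((rx₁≤x , x≤rx₂) , (ry₁≤y , y≤ry₂)) , ((sx₁≤x , x≤sx₂) , (sy₁≤y , y≤sy₂))) =
  (ℚ.≤-trans rx₁≤x x≤sx₂ , ℚ.≤-trans sx₁≤x x≤rx₂) ,
  (ℚ.≤-trans ry₁≤y y≤sy₂ , ℚ.≤-trans sy₁≤y y≤ry₂)

intersect⇔overlap : ∀ r s → NonEmpty r → NonEmpty s → Intersect r s ⇔ Overlap² r s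
intersect⇔overlap r s (rx , ry) (sx , sy) = mk⇔ intersect⇒overlap overlap⇒intersect
  where
  overlap⇒intersect : Overlap² r s → Intersect r s
  overlap⇒intersect (ox , oy) with common-point rx sx ox | common-point ry sy oy
  ... | x , x∈r , x∈s | y , y∈r , y∈s = (x , y) , (x∈r , y∈r) , (x∈s , y∈s)

module ThresholdBoxes {m n : ℕ} (A : BiadjMatrix m n) {F₁ F₂ : BiadjMatrix m n}
  (T₁ : Threshold F₁) (T₂ : Threshold F₂) (A≡F₁∧F₂ : ∀ i j → A i j ≡ (F₁ i j ∧ F₂ i j)) where
  open Threshold T₁ renaming (deg to deg₁; thr to thr₁; thr≤n to thr₁≤n; spec to spec₁)
  open Threshold T₂ renaming (deg to deg₂; thr to thr₂; thr≤n to thr₂≤n; spec to spec₂)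

  box : Fin m ⊎ Fin n → Rect
  box (inj₁ i) = rect (toℚ 0) (toℚ (deg₁ i)) (toℚ 0) (toℚ (deg₂ i))
  box (inj₂ j) = rect (toℚ (thr₁ j)) (toℚ n) (toℚ (thr₂ j)) (toℚ n)

  nonEmpty : ∀ v → NonEmpty (box v)
  nonEmpty (inj₁ i) = to toℚ-≤ z≤n , to toℚ-≤ z≤n
  nonEmpty (inj₂ j) = to toℚ-≤ (thr₁≤n j) , to toℚ-≤ (thr₂≤n j)

  intersect⇔overlap-box : ∀ u v → Intersect (box u) (box v) ⇔ Overlap² (box u) (box v)
  intersect⇔overlap-box u v = intersect⇔overlap (box u) (box v) (nonEmpty u) (nonEmpty v)

  corner-overlap : ∀ d t N → Overlap (toℚ 0 , toℚ d) (toℚ t , toℚ N) ⇔ t ℕ.≤ d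
  corner-overlap _ _ _ = mk⇔ (λ (_ , t≤d) → from toℚ-≤ t≤d) (λ t≤d → to toℚ-≤ z≤n , to toℚ-≤ t≤d)

  edge : ∀ i j → A i j ≡ true ⇔ Intersect (box (inj₁ i)) (box (inj₂ j))
  edge i j = begin
    A i j ≡ true                               ∼⟨ ≡-true-cong (A≡F₁∧F₂ i j) ⟩
    F₁ i j ∧ F₂ i j ≡ true                     ∼⟨ ∧-true ⟩
    (F₁ i j ≡ true × F₂ i j ≡ true)            ∼⟨ spec₁ i j ×-⇔ spec₂ i j ⟩
    (thr₁ j ℕ.≤ deg₁ i × thr₂ j ℕ.≤ deg₂ i)    ∼⟨ ⇔.sym (corner-overlap (deg₁ i) (thr₁ j) n
                                                          ×-⇔ corner-overlap (deg₂ i) (thr₂ j) n) ⟩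
    Overlap² (box (inj₁ i)) (box (inj₂ j))     ∼⟨ ⇔.sym (intersect⇔overlap-box (inj₁ i) (inj₂ j)) ⟩
    Intersect (box (inj₁ i)) (box (inj₂ j))    ∎
    where open EquationalReasoning

  -- All row boxes contain the origin.
  row-clique : ∀ i i' → Intersect (box (inj₁ i)) (box (inj₁ i'))
  row-clique i i' = from (intersect⇔overlap-box (inj₁ i) (inj₁ i'))
    ((to toℚ-≤ z≤n , to toℚ-≤ z≤n) , (to toℚ-≤ z≤n , to toℚ-≤ z≤n))

  -- All column boxes contain the corner (n , n).
  column-clique : ∀ j j' → Intersect (box (inj₂ j)) (box (inj₂ j'))
  column-clique j j' = from (intersect⇔overlap-box (inj₂ j) (inj₂ j'))
    ((to toℚ-≤ (thr₁≤n j) , to toℚ-≤ (thr₁≤n j')) , (to toℚ-≤ (thr₂≤n j) , to toℚ-≤ (thr₂≤n j')))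

  rectangular : Rectangular (hat A)
  rectangular = box , represents
    where
    represents : ∀ u v → hat A u v ≡ true ⇔ Intersect (box u) (box v)
    represents (inj₁ i) (inj₁ i') = always (row-clique i i')
    represents (inj₁ i) (inj₂ j)  = edge i j
    represents (inj₂ j) (inj₁ i)  = ⇔.trans (edge i j) intersect-sym
    represents (inj₂ j) (inj₂ j') = always (column-clique j j')

hat-reflexive : ∀ {m n} (A : BiadjMatrix m n) v → hat A v v ≡ true
hat-reflexive A (inj₁ _) = refl
hat-reflexive A (inj₂ _) = refl

module BoxProjections {m n : ℕ} (A : BiadjMatrix m n) (R : Fin m ⊎ Fin n → Rect)
  (represents : ∀ u v → hat A u v ≡ true ⇔ Intersect (R u) (R v)) where

  -- The loops of hat A force every box to be nonempty.
  nonEmpty : ∀ v → NonEmpty (R v)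
  nonEmpty v = intersect⇒nonEmpty (to (represents v v) (hat-reflexive A v))

  adjacent-overlap : ∀ {u v} → hat A u v ≡ true → Overlap² (R u) (R v)
  adjacent-overlap {u} {v} uv = intersect⇒overlap (to (represents u v) uv)

  Fx Fy : BiadjMatrix m n
  Fx i j = does (overlap? (xI (R (inj₁ i))) (xI (R (inj₂ j))))
  Fy i j = does (overlap? (yI (R (inj₁ i))) (yI (R (inj₂ j))))

  Fx-ferrers : Ferrers Fx
  Fx-ferrers = overlap-ferrers (λ i → xI (R (inj₁ i))) (λ j → xI (R (inj₂ j)))
    (λ i i' → proj₁ (adjacent-overlap {inj₁ i} {inj₁ i'} refl))
    (λ j j' → proj₁ (adjacent-overlap {inj₂ j} {inj₂ j'} refl))

  Fy-ferrers : Ferrers Fy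
  Fy-ferrers = overlap-ferrers (λ i → yI (R (inj₁ i))) (λ j → yI (R (inj₂ j)))
    (λ i i' → proj₂ (adjacent-overlap {inj₁ i} {inj₁ i'} refl))
    (λ j j' → proj₂ (adjacent-overlap {inj₂ j} {inj₂ j'} refl))

  A≡Fx∧Fy : ∀ i j → A i j ≡ (Fx i j ∧ Fy i j)
  A≡Fx∧Fy i j = bool-ext (begin
    A i j ≡ true                              ∼⟨ represents (inj₁ i) (inj₂ j) ⟩
    Intersect (R (inj₁ i)) (R (inj₂ j))       ∼⟨ intersect⇔overlap _ _ (nonEmpty (inj₁ i)) (nonEmpty (inj₂ j)) ⟩
    Overlap² (R (inj₁ i)) (R (inj₂ j))        ∼⟨ ⇔.sym (does-true (overlap? _ _) ×-⇔ does-true (overlap? _ _)) ⟩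
    (Fx i j ≡ true × Fy i j ≡ true)           ∼⟨ ⇔.sym ∧-true ⟩
    Fx i j ∧ Fy i j ≡ true                    ∎)
    where open EquationalReasoning

  ferrersDim2 : FerrersDimAtMost2 A
  ferrersDim2 = Fx , Fy , Fx-ferrers , Fy-ferrers , A≡Fx∧Fy

partite-cover : ∀ {m n} (A : BiadjMatrix m n) → TwoCliqueCover (hat A)
partite-cover {m} {n} A = side , same-side-adjacent
  where
  side : Fin m ⊎ Fin n → Bool
  side (inj₁ _) = true
  side (inj₂ _) = false
  same-side-adjacent : ∀ u v → ¬ (u ≡ v) → side u ≡ side v → hat A u v ≡ true
  same-side-adjacent (inj₁ _) (inj₁ _) _ _  = refl
  same-side-adjacent (inj₂ _) (inj₂ _) _ _  = refl
  same-side-adjacent (inj₁ _) (inj₂ _) _ ()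
  same-side-adjacent (inj₂ _) (inj₁ _) _ ()

corollary4 : (m n : ℕ) (A : BiadjMatrix m n) →
    FerrersDimAtMost2 A ⇔ TwoCliqueRectangular (hat A)
corollary4 m n A = mk⇔ ferrers⇒rectangular rectangular⇒ferrers
  where
  ferrers⇒rectangular : FerrersDimAtMost2 A → TwoCliqueRectangular (hat A)
  ferrers⇒rectangular (F₁ , F₂ , fer₁ , fer₂ , A≡F₁∧F₂) =
    ThresholdBoxes.rectangular A (FerrersThreshold.threshold F₁ fer₁)
                                 (FerrersThreshold.threshold F₂ fer₂) A≡F₁∧F₂
    , partite-cover A
  rectangular⇒ferrers : TwoCliqueRectangular (hat A) → FerrersDimAtMost2 A
  rectangular⇒ferrers ((R , represents) , _) = BoxProjections.ferrersDim2 A R represents
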